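{- Let $a,b,c$ be integers with $3\le a\le b\le c\le a+b$. Then $F(a)^2+F(b)^2+F(c)^2-3F(a)F(b)F(c)<0$.
   Context: $F(n)$ denotes the $n$-th Fibonacci number, $F(0)=0$, $F(1)=1$, $F(n+1)=F(n)+F(n-1)$. -}

module Defs where

open import Data.Nat using (ℕ; zero; suc; _+_)

F : ℕ → ℕ
F zero = 0
F (suc zero) = 1
F (suc (suc n)) = F (suc n) + F n

{-# OPTIONS --safe #-}
module Submission where

-- Put x = F a, y = F b, z = F c.  Writing z = y + d, one has
-- x² + y² + z² = x² + 2y² + d(z + y) and 3xyz = 3xy·y + d·3xy, so it suffices that
-- x² + 2y² < 3xy² (true as 2 ≤ x ≤ y) and z + y ≤ 3xy.  The latter follows from
-- z ≤ F (a + b), the addition formula F (a + b) = F (a + 1) F b + F a F (b - 1), and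
-- the ratio x[y+v]+uy+y≤3xy 3 F (n - 1) ≤ 2 F n for n ≥ 3.

open import Defs
open import Data.Nat using (ℕ; _≤_)
open import Data.Nat.Properties using (≤-trans; +-monoˡ-≤)
open import Relation.Binary.PropositionalEquality
  using (_≡_; refl; sym; trans; cong; cong₂; subst₂; module ≡-Reasoning)

module NatInequalities where

  open import Data.Nat using (suc; _+_; _*_; _<_; _≤′_; ≤′-refl; ≤′-step; z≤n; s≤s; z<s; >-nonZero)
  open import Data.Nat.Properties
  open import Data.Nat.Tactic.RingSolver using (solve; solve-∀)
  open import Data.List using (_∷_; [])
  open import Data.Product using (_,_)
  open import Function using (_∘_)

  F[n]≤F[1+n] : ∀ n → F n ≤ F (suc n)
  F[n]≤F[1+n] 0       = z≤n
  F[n]≤F[1+n] (suc n) = m≤m+n (F (suc n)) (F n)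

  F-mono-≤ : ∀ {m n} → m ≤ n → F m ≤ F n
  F-mono-≤ = F-mono-≤′ ∘ ≤⇒≤′
    where
    F-mono-≤′ : ∀ {m n} → m ≤′ n → F m ≤ F n
    F-mono-≤′ ≤′-refl             = ≤-refl
    F-mono-≤′ (≤′-step {n} m≤′n) = ≤-trans (F-mono-≤′ m≤′n) (F[n]≤F[1+n] n)

  F[1+m+n]≡F[1+m]F[1+n]+F[m]F[n] : ∀ m n → F (suc (m + n)) ≡ F (suc m) * F (suc n) + F m * F n
  F[1+m+n]≡F[1+m]F[1+n]+F[m]F[n] 0       n = sym (trans (+-identityʳ _) (+-identityʳ _))
  F[1+m+n]≡F[1+m]F[1+n]+F[m]F[n] (suc m) n = begin
    F (suc (suc m + n))                                  ≡⟨ cong (F ∘ suc) (sym (+-suc m n)) ⟩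
    F (suc (m + suc n))                                  ≡⟨ F[1+m+n]≡F[1+m]F[1+n]+F[m]F[n] m (suc n) ⟩
    F (suc m) * (F (suc n) + F n) + F m * F (suc n)      ≡⟨ regroup (F (suc m)) (F m) (F (suc n)) (F n) ⟩
    (F (suc m) + F m) * F (suc n) + F (suc m) * F n      ∎
    where
    open ≡-Reasoning
    regroup : ∀ a b c d → a * (c + d) + b * c ≡ (a + b) * c + a * d
    regroup = solve-∀

  3F[n]≤2F[1+n] : ∀ {n} → 2 ≤ n → 3 * F n ≤ 2 * F (suc n)
  3F[n]≤2F[1+n] {suc (suc n)} (s≤s (s≤s z≤n)) = 3[a+b]≤2[a+b+a] (F (suc n)) (F n) (F[n]≤F[1+n] n)
    where
    open ≤-Reasoning
    3[a+b]≤2[a+b+a] : ∀ a b → b ≤ a → 3 * (a + b) ≤ 2 * (a + b + a)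
    3[a+b]≤2[a+b+a] a b b≤a = begin
      3 * (a + b)            ≡⟨ solve (a ∷ b ∷ []) ⟩
      2 * (a + b) + (a + b)  ≤⟨ +-monoʳ-≤ (2 * (a + b)) (+-monoʳ-≤ a b≤a) ⟩
      2 * (a + b) + (a + a)  ≡⟨ solve (a ∷ b ∷ []) ⟩
      2 * (a + b + a)        ∎

  F[m+n]+F[n]≤3F[m]F[n] : ∀ {m n} → 3 ≤ m → 3 ≤ n → F (m + n) + F n ≤ 3 * F m * F n
  F[m+n]+F[n]≤3F[m]F[n] {suc m} {suc n} (s≤s 2≤m) (s≤s 2≤n) = begin
    F (suc (m + suc n)) + F (suc n)
      ≡⟨ cong (_+ F (suc n)) (F[1+m+n]≡F[1+m]F[1+n]+F[m]F[n] m (suc n)) ⟩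
    F (suc m) * (F (suc n) + F n) + F m * F (suc n) + F (suc n)
      ≤⟨ x[y+v]+uy+y≤3xy (F (suc m)) (F m) (F (suc n)) (F n)
           (F-mono-≤ (s≤s 2≤m)) (3F[n]≤2F[1+n] 2≤m) (3F[n]≤2F[1+n] 2≤n) ⟩
    3 * F (suc m) * F (suc n) ∎
    where
    open ≤-Reasoning
    x[y+v]+uy+y≤3xy : ∀ x u y v → 2 ≤ x → 3 * u ≤ 2 * x → 3 * v ≤ 2 * y →
                      x * (y + v) + u * y + y ≤ 3 * x * y
    x[y+v]+uy+y≤3xy x u y v 2≤x 3u≤2x 3v≤2y = *-cancelˡ-≤ 3 (begin
      3 * (x * (y + v) + u * y + y)                   ≡⟨ solve (x ∷ u ∷ y ∷ v ∷ []) ⟩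
      3 * x * y + x * (3 * v) + 3 * u * y + 3 * y     ≤⟨ +-mono-≤ (+-mono-≤ (+-monoʳ-≤ (3 * x * y) (*-monoʳ-≤ x 3v≤2y))
                                                                         (*-monoˡ-≤ y 3u≤2x))
                                                               (*-monoˡ-≤ y (≤-trans (n≤1+n 3) (*-monoʳ-≤ 2 2≤x))) ⟩
      3 * x * y + x * (2 * y) + 2 * x * y + 2 * x * y ≡⟨ solve (x ∷ y ∷ []) ⟩
      3 * (3 * x * y)                                 ∎)

  x²+y²+z²<3xyz : ∀ {x y z} → 2 ≤ x → x ≤ y → y ≤ z → z + y ≤ 3 * x * y →
                  x * x + y * y + z * z < 3 * x * y * z
  x²+y²+z²<3xyz {x} {y} 2≤x x≤y y≤z z+y≤3xy with m≤n⇒∃[o]m+o≡n y≤z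
  ... | d , refl = begin-strict
    x * x + y * y + (y + d) * (y + d)        ≡⟨ solve (x ∷ y ∷ d ∷ []) ⟩
    x * x + 2 * (y * y) + d * ((y + d) + y)  <⟨ +-mono-<-≤ x²+2y²<3xy² (*-monoʳ-≤ d z+y≤3xy) ⟩
    3 * x * y * y + d * (3 * x * y)          ≡⟨ solve (x ∷ y ∷ d ∷ []) ⟩
    3 * x * y * (y + d)                      ∎
    where
    open ≤-Reasoning
    0<y : 0 < y
    0<y = <-≤-trans z<s (≤-trans 2≤x x≤y)
    0<3y² : 0 < 3 * (y * y)
    0<3y² = *-mono-< {0} {3} z<s (*-mono-< 0<y 0<y)
    x²+2y²<3xy² : x * x + 2 * (y * y) < 3 * x * y * y
    x²+2y²<3xy² = begin-strict
      x * x + 2 * (y * y)    ≤⟨ +-monoˡ-≤ (2 * (y * y)) (*-mono-≤ x≤y x≤y) ⟩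
      y * y + 2 * (y * y)    ≡⟨ solve (y ∷ []) ⟩
      3 * (y * y)            <⟨ m<m*n (3 * (y * y)) x {{>-nonZero 0<3y²}} 2≤x ⟩
      3 * (y * y) * x        ≡⟨ solve (x ∷ y ∷ []) ⟩
      3 * x * y * y          ∎

open NatInequalities

import Data.Nat as ℕ
open import Data.Integer using (+_; -_; _+_; _-_; _*_; _<_; +<+)
open import Data.Integer.Properties using (pos-+; pos-*; +-monoˡ-<; +-inverseʳ; <-≤-trans; ≤-reflexive)

i<j⇒i-j<0 : ∀ {i j} → i < j → i - j < + 0
i<j⇒i-j<0 {i} {j} i<j = <-≤-trans (+-monoˡ-< (- j) i<j) (≤-reflexive (+-inverseʳ j))

x²+y²+z²-3xyz<0 : ∀ x y z → x ℕ.* x ℕ.+ y ℕ.* y ℕ.+ z ℕ.* z ℕ.< 3 ℕ.* x ℕ.* y ℕ.* z →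
                  (+ x) * (+ x) + (+ y) * (+ y) + (+ z) * (+ z) - (+ 3) * (+ x) * (+ y) * (+ z) < + 0
x²+y²+z²-3xyz<0 x y z lt = i<j⇒i-j<0 (subst₂ _<_ sum-of-squares triple-product (+<+ lt))
  where
  sum-of-squares : + (x ℕ.* x ℕ.+ y ℕ.* y ℕ.+ z ℕ.* z) ≡ (+ x) * (+ x) + (+ y) * (+ y) + (+ z) * (+ z)
  sum-of-squares = trans (pos-+ (x ℕ.* x ℕ.+ y ℕ.* y) (z ℕ.* z))
    (cong₂ _+_ (trans (pos-+ (x ℕ.* x) (y ℕ.* y)) (cong₂ _+_ (pos-* x x) (pos-* y y))) (pos-* z z))
  triple-product : + (3 ℕ.* x ℕ.* y ℕ.* z) ≡ (+ 3) * (+ x) * (+ y) * (+ z)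
  triple-product = trans (pos-* (3 ℕ.* x ℕ.* y) z)
    (cong (_* + z) (trans (pos-* (3 ℕ.* x) y) (cong (_* + y) (pos-* 3 x))))

lemma3p2 : (a b c : ℕ) → 3 ≤ a → a ≤ b → b ≤ c → c ≤ a Data.Nat.+ b →
    (+ F a) * (+ F a) + (+ F b) * (+ F b) + (+ F c) * (+ F c)
      - (+ 3) * (+ F a) * (+ F b) * (+ F c) < + 0
lemma3p2 a b c 3≤a a≤b b≤c c≤a+b =
  x²+y²+z²-3xyz<0 (F a) (F b) (F c)
    (x²+y²+z²<3xyz (F-mono-≤ 3≤a) (F-mono-≤ a≤b) (F-mono-≤ b≤c) F[c]+F[b]≤3F[a]F[b])
  where
  F[c]+F[b]≤3F[a]F[b] : F c ℕ.+ F b ≤ 3 ℕ.* F a ℕ.* F b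
  F[c]+F[b]≤3F[a]F[b] = ≤-trans (+-monoˡ-≤ (F b) (F-mono-≤ c≤a+b))
                                (F[m+n]+F[n]≤3F[m]F[n] 3≤a (≤-trans 3≤a a≤b))
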